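{- Let $R$ be a group and $X$ a nonempty inverse-closed subset of $R$. For every nonnegative integer $k$, the number of inverse-closed subsets of $X$ of size $k$ is at most $2^{\mathbf{c}(X)-1}$.
   Context: $\mathcal{I}(X)$ is the set of elements of $X$ of order at most $2$, and $\mathbf{c}(X)=(|X|+|\mathcal{I}(X)|)/2$. A subset $Y$ is inverse-closed if $Y=Y^{ -1}$. -}

module Defs where

open import Level using (Level)
open import Algebra.Bundles using (Group)
open import Data.Nat using (ℕ; _+_; _/_)
open import Data.Fin using (Fin)
open import Data.Fin.Subset using (Subset; _∈_; ∣_∣)
open import Data.Product using (Σ; _×_)
open import Relation.Binary.PropositionalEquality using (_≡_)

module _ {c ℓ : Level} (G : Group c ℓ) where
  open Group G

  -- A finite subset X of G with n elements, given as an injective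
  -- enumeration e : Fin n → Carrier (X = image of e).
  InjectiveEnum : {n : ℕ} → (Fin n → Carrier) → Set ℓ
  InjectiveEnum {n} e = ∀ (i j : Fin n) → e i ≈ e j → i ≡ j

  InvClosedEnum : {n : ℕ} → (Fin n → Carrier) → Set ℓ
  InvClosedEnum {n} e = ∀ (i : Fin n) → Σ (Fin n) λ j → e j ≈ e i ⁻¹

  -- A subset S of X (given as a subset of the index set Fin n) is
  -- inverse-closed: for every x ∈ S, x⁻¹ ∈ S.
  InvClosedSub : {n : ℕ} → (Fin n → Carrier) → Subset n → Set ℓ
  InvClosedSub {n} e S =
    ∀ (i : Fin n) → i ∈ S → Σ (Fin n) λ j → (j ∈ S) × (e j ≈ e i ⁻¹)

  IsInvolSet : {n : ℕ} → (Fin n → Carrier) → Subset n → Set ℓ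
  IsInvolSet {n} e I =
    ∀ (i : Fin n) → (i ∈ I → e i ∙ e i ≈ ε) × (e i ∙ e i ≈ ε → i ∈ I)

cX : {n : ℕ} → Subset n → ℕ
cX {n} I = (n + ∣ I ∣) / 2

-- Inversion x ↦ x⁻¹ is an involution σ of X whose fixed points are exactly
-- 𝓘(X), and the inverse-closed subsets of X are the σ-invariant ones.  A set R
-- meeting every σ-orbit can be chosen with 2|R| ≤ |X| + |𝓘(X)|, e.g. the smaller
-- of {x : x ≤ σx} and {x : σx ≤ x} for a linear order of X.  An invariant S is
-- a union of orbits, hence determined by S ∩ R; among invariant sets of one
-- fixed size it is even determined by S ∩ (R - r) for any r, because whether the
-- orbit of r lies in S is forced by |S|.  So there are at most 2^(|R|-1) of
-- them, and |R| ≤ 𝐜(X).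
module Submission where

open import Defs
open import Level using (Level; 0ℓ)
open import Algebra.Bundles using (Group)
import Algebra.Properties.Group as GroupProperties
open import Data.Bool using (Bool) renaming (_≟_ to _≟ᵇ_)
open import Data.Fin using (Fin; fromℕ<) renaming (_≟_ to _≟ᶠ_)
import Data.Fin.Properties as Fin
open import Data.Fin.Subset
  using (Subset; inside; outside; _∈_; _⊆_; _∩_; _∪_; _-_; ∣_∣; Nonempty)
open import Data.Fin.Subset.Properties
  using ( ∣p∣≤n; p⊆q⇒∣p∣≤∣q∣; p⊂q⇒∣p∣<∣q∣; x∈p⇒∣p-x∣<∣p∣; _∈?_; p∩q⊆p; p∩q⊆q
        ; x∈p∩q⁺; x∈p∩q⁻; x∈p∧x≢y⇒x∈p-y; ⊆-antisym; drop-∷-⊆)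
open import Data.List using (List; []; _∷_; length; map)
open import Data.List.Properties using (length-map)
open import Data.List.Relation.Unary.All as All using (All; []; _∷_)
open import Data.List.Relation.Unary.All.Properties as All using ()
open import Data.List.Relation.Unary.AllPairs as AllPairs using (AllPairs; []; _∷_)
import Data.List.Relation.Unary.AllPairs.Properties as AllPairs
open import Data.List.Relation.Unary.Unique.Propositional using (Unique)
open import Data.Nat
  using (ℕ; suc; _+_; _*_; _^_; _∸_; _/_; _≤_; _<_; z≤n)
open import Data.Nat.Properties
  using ( ≤-refl; ≤-reflexive; ≤-trans; ≤⇒≯; +-suc; +-comm; +-identityʳ; *-comm
        ; +-mono-≤; +-monoʳ-≤; ^-monoʳ-≤; ∸-monoˡ-≤; ≰⇒≥; module ≤-Reasoning)
  renaming (_≤?_ to _≤?ⁿ_)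
open import Data.Nat.DivMod using (m*n/n≡m; /-monoˡ-≤)
open import Data.Product using (∃; _×_; _,_; proj₁; proj₂)
import Data.Product as Product
open import Data.Sum using (_⊎_; inj₁; inj₂)
open import Data.Vec using ([]; _∷_; tabulate; here)
open import Data.Vec.Properties using (lookup∘tabulate; lookup⇒[]=; []=⇒lookup)
open import Function using (_∘_; flip)
open import Relation.Binary using (Rel; Total) renaming (Decidable to Decidable₂)
import Relation.Binary.Reasoning.Setoid
open import Relation.Binary.PropositionalEquality
  using (_≡_; _≢_; refl; sym; trans; cong; subst)
open import Relation.Nullary using (yes; no; does; contradiction)
open import Relation.Nullary.Decidable using (dec-true)
open import Relation.Unary using (Pred; Decidable)

private
  variable
    a p : Level
    A B : Set a
    n : ℕ

2*m≤m+n : ∀ {m n} → m ≤ n → 2 * m ≤ m + n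
2*m≤m+n {m} m≤n = +-monoʳ-≤ m (≤-trans (≤-reflexive (+-identityʳ m)) m≤n)

2*m≤k⇒m≤k/2 : ∀ {m k} → 2 * m ≤ k → m ≤ k / 2
2*m≤k⇒m≤k/2 {m} {k} 2m≤k = begin
  m          ≡⟨ sym (m*n/n≡m m 2) ⟩
  m * 2 / 2  ≤⟨ /-monoˡ-≤ 2 (≤-trans (≤-reflexive (*-comm m 2)) 2m≤k) ⟩
  k / 2      ∎
  where open ≤-Reasoning

map⁺-injectiveOn : ∀ {P : Pred A p} {f : A → B} →
                   (∀ {x y} → P x → P y → f x ≡ f y → x ≡ y) →
                   ∀ {xs} → All P xs → Unique xs → Unique (map f xs)
map⁺-injectiveOn {P = P} {f} inj pxs u = AllPairs.map⁺ (distinctImages pxs u)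
  where
  distinctImages : ∀ {xs} → All P xs → Unique xs → AllPairs (λ x y → f x ≢ f y) xs
  distinctImages []         []             = []
  distinctImages (px ∷ pxs) (x∉xs ∷ u) =
    All.zipWith (λ (py , x≢y) → x≢y ∘ inj px py) (pxs , x∉xs) ∷ distinctImages pxs u

∣p∣+∣q∣≡∣p∪q∣+∣p∩q∣ : ∀ (p q : Subset n) → ∣ p ∣ + ∣ q ∣ ≡ ∣ p ∪ q ∣ + ∣ p ∩ q ∣
∣p∣+∣q∣≡∣p∪q∣+∣p∩q∣ []            []            = refl
∣p∣+∣q∣≡∣p∪q∣+∣p∩q∣ (outside ∷ p) (outside ∷ q) = ∣p∣+∣q∣≡∣p∪q∣+∣p∩q∣ p q
∣p∣+∣q∣≡∣p∪q∣+∣p∩q∣ (inside  ∷ p) (outside ∷ q) = cong suc (∣p∣+∣q∣≡∣p∪q∣+∣p∩q∣ p q)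
∣p∣+∣q∣≡∣p∪q∣+∣p∩q∣ (outside ∷ p) (inside  ∷ q) =
  trans (+-suc ∣ p ∣ ∣ q ∣) (cong suc (∣p∣+∣q∣≡∣p∪q∣+∣p∩q∣ p q))
∣p∣+∣q∣≡∣p∪q∣+∣p∩q∣ (inside  ∷ p) (inside  ∷ q) = cong suc (begin
  ∣ p ∣ + suc ∣ q ∣                 ≡⟨ +-suc ∣ p ∣ ∣ q ∣ ⟩
  suc (∣ p ∣ + ∣ q ∣)               ≡⟨ cong suc (∣p∣+∣q∣≡∣p∪q∣+∣p∩q∣ p q) ⟩
  suc (∣ p ∪ q ∣ + ∣ p ∩ q ∣)       ≡⟨ sym (+-suc ∣ p ∪ q ∣ ∣ p ∩ q ∣) ⟩
  ∣ p ∪ q ∣ + suc ∣ p ∩ q ∣         ∎)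
  where open Relation.Binary.PropositionalEquality.≡-Reasoning

select : {P : Pred (Fin n) p} → Decidable P → Subset n
select P? = tabulate (does ∘ P?)

module _ {P : Pred (Fin n) p} (P? : Decidable P) where

  ∈-select⁺ : ∀ {i} → P i → i ∈ select P?
  ∈-select⁺ {i} pi = lookup⇒[]= i _ (trans (lookup∘tabulate _ i) (dec-true (P? i) pi))

  ∈-select⁻ : ∀ {i} → i ∈ select P? → P i
  ∈-select⁻ {i} i∈ with P? i | trans (sym (lookup∘tabulate (does ∘ P?) i)) ([]=⇒lookup i∈)
  ... | yes pi | _ = pi
  ... | no  _  | ()

module _ {n : ℕ} where

  tailsWith : Bool → List (Subset (suc n)) → List (Subset n)
  tailsWith b []              = []
  tailsWith b ((x ∷ q) ∷ qs) with x ≟ᵇ b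
  ... | yes _ = q ∷ tailsWith b qs
  ... | no  _ = tailsWith b qs

  length-tailsWith : ∀ qs →
    length qs ≡ length (tailsWith inside qs) + length (tailsWith outside qs)
  length-tailsWith []                   = refl
  length-tailsWith ((inside  ∷ q) ∷ qs) = cong suc (length-tailsWith qs)
  length-tailsWith ((outside ∷ q) ∷ qs) =
    trans (cong suc (length-tailsWith qs)) (sym (+-suc _ _))

  tailsWith-fresh : ∀ b q qs → All (b ∷ q ≢_) qs → All (q ≢_) (tailsWith b qs)
  tailsWith-fresh b q []              []           = []
  tailsWith-fresh b q ((x ∷ r) ∷ qs) (bq≢xr ∷ fresh) with x ≟ᵇ b
  ... | yes refl = (bq≢xr ∘ cong (b ∷_)) ∷ tailsWith-fresh b q qs fresh
  ... | no  _    = tailsWith-fresh b q qs fresh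

  tailsWith-unique : ∀ b {qs} → Unique qs → Unique (tailsWith b qs)
  tailsWith-unique b {[]}             []           = []
  tailsWith-unique b {(x ∷ q) ∷ qs} (fresh ∷ u) with x ≟ᵇ b
  ... | yes refl = tailsWith-fresh b q qs fresh ∷ tailsWith-unique b u
  ... | no  _    = tailsWith-unique b u

  tailsWith-⊆ : ∀ b {y r} qs → All (_⊆ y ∷ r) qs → All (_⊆ r) (tailsWith b qs)
  tailsWith-⊆ b []              []          = []
  tailsWith-⊆ b ((x ∷ q) ∷ qs) (xq⊆ ∷ qs⊆) with x ≟ᵇ b
  ... | yes _ = drop-∷-⊆ xq⊆ ∷ tailsWith-⊆ b qs qs⊆
  ... | no  _ = tailsWith-⊆ b qs qs⊆

  tailsWith-inside≡[] : ∀ {r} qs → All (_⊆ outside ∷ r) qs → tailsWith inside qs ≡ []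
  tailsWith-inside≡[] []                   []          = refl
  tailsWith-inside≡[] ((outside ∷ q) ∷ qs) (_ ∷ qs⊆)   = tailsWith-inside≡[] qs qs⊆
  tailsWith-inside≡[] ((inside  ∷ q) ∷ qs) (iq⊆ ∷ _) with iq⊆ here
  ... | ()

length-unique-⊆≤2^∣_∣ : ∀ (r : Subset n) {qs} → Unique qs → All (_⊆ r) qs → length qs ≤ 2 ^ ∣ r ∣
length-unique-⊆≤2^∣ [] ∣ {[]}          _                 _ = z≤n
length-unique-⊆≤2^∣ [] ∣ {[] ∷ []}     _                 _ = ≤-refl
length-unique-⊆≤2^∣ [] ∣ {[] ∷ [] ∷ _} ((≢[] ∷ _) ∷ _) _ = contradiction refl ≢[]
length-unique-⊆≤2^∣ inside ∷ r ∣ {qs} u qs⊆ = begin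
  length qs                                                     ≡⟨ length-tailsWith qs ⟩
  length (tailsWith inside qs) + length (tailsWith outside qs)  ≤⟨ +-mono-≤ (bound inside) (bound outside) ⟩
  2 ^ ∣ r ∣ + 2 ^ ∣ r ∣                                         ≡⟨ cong (2 ^ ∣ r ∣ +_) (sym (+-identityʳ _)) ⟩
  2 ^ ∣ inside ∷ r ∣                                            ∎
  where
  open ≤-Reasoning
  bound : ∀ b → length (tailsWith b qs) ≤ 2 ^ ∣ r ∣
  bound b = length-unique-⊆≤2^∣ r ∣ (tailsWith-unique b u) (tailsWith-⊆ b qs qs⊆)
length-unique-⊆≤2^∣ outside ∷ r ∣ {qs} u qs⊆ = begin
  length qs                                                     ≡⟨ length-tailsWith qs ⟩
  length (tailsWith inside qs) + length (tailsWith outside qs)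
    ≡⟨ cong (λ ps → length ps + length (tailsWith outside qs)) (tailsWith-inside≡[] qs qs⊆) ⟩
  length (tailsWith outside qs)
    ≤⟨ length-unique-⊆≤2^∣ r ∣ (tailsWith-unique outside u) (tailsWith-⊆ outside qs qs⊆) ⟩
  2 ^ ∣ r ∣                                                     ∎
  where open ≤-Reasoning

module Involution {n : ℕ} (σ : Fin n → Fin n) (σ-involutive : ∀ i → σ (σ i) ≡ i) where

  Invariant : Subset n → Set
  Invariant s = ∀ {i} → i ∈ s → σ i ∈ s

  Transversal : Subset n → Set
  Transversal r = ∀ i → i ∈ r ⊎ σ i ∈ r

  ∈-σσ : ∀ {i s} → σ (σ i) ∈ s → i ∈ s
  ∈-σσ {i} {s} = subst (_∈ s) (σ-involutive i)

  transversal-nonempty : ∀ {r} → 0 < n → Transversal r → Nonempty r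
  transversal-nonempty 0<n r-tr with r-tr (fromℕ< 0<n)
  ... | inj₁ i∈r  = _ , i∈r
  ... | inj₂ σi∈r = _ , σi∈r

  module _ {r : Subset n} (r-transversal : Transversal r) (x : Fin n) where

    ⊆-fromRestriction : ∀ {s t} → Invariant s → Invariant t →
                        s ∩ (r - x) ⊆ t → (x ∈ s → x ∈ t) → s ⊆ t
    ⊆-fromRestriction s-inv t-inv agree x∈s⇒x∈t {i} i∈s with i ≟ᶠ x | σ i ≟ᶠ x
    ... | yes i≡x | _ = subst (_∈ _) (sym i≡x) (x∈s⇒x∈t (subst (_∈ _) i≡x i∈s))
    ... | no _ | yes σi≡x =
      ∈-σσ (t-inv (subst (_∈ _) (sym σi≡x) (x∈s⇒x∈t (subst (_∈ _) σi≡x (s-inv i∈s)))))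
    ... | no i≢x | no σi≢x with r-transversal i
    ...   | inj₁ i∈r  = agree (x∈p∩q⁺ (i∈s , x∈p∧x≢y⇒x∈p-y i∈r i≢x))
    ...   | inj₂ σi∈r = ∈-σσ (t-inv (agree (x∈p∩q⁺ (s-inv i∈s , x∈p∧x≢y⇒x∈p-y σi∈r σi≢x))))

    ∈-fromRestriction : ∀ {s t} → Invariant s → Invariant t → ∣ s ∣ ≡ ∣ t ∣ →
                        s ∩ (r - x) ⊆ t → t ∩ (r - x) ⊆ s → x ∈ s → x ∈ t
    ∈-fromRestriction {s} {t} s-inv t-inv ∣s∣≡∣t∣ _ t-agree x∈s with x ∈? t
    ... | yes x∈t = x∈t
    ... | no  x∉t = contradiction (p⊂q⇒∣p∣<∣q∣ (t⊆s , x , x∈s , x∉t)) (≤⇒≯ (≤-reflexive ∣s∣≡∣t∣))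
      where
      t⊆s : t ⊆ s
      t⊆s = ⊆-fromRestriction t-inv s-inv t-agree (λ x∈t → contradiction x∈t x∉t)

    invariant-injective : ∀ {s t} → Invariant s → Invariant t → ∣ s ∣ ≡ ∣ t ∣ →
                          s ∩ (r - x) ≡ t ∩ (r - x) → s ≡ t
    invariant-injective {s} {t} s-inv t-inv ∣s∣≡∣t∣ eq = ⊆-antisym
      (⊆-fromRestriction s-inv t-inv s-agree (∈-fromRestriction s-inv t-inv ∣s∣≡∣t∣ s-agree t-agree))
      (⊆-fromRestriction t-inv s-inv t-agree (∈-fromRestriction t-inv s-inv (sym ∣s∣≡∣t∣) t-agree s-agree))
      where
      s-agree : s ∩ (r - x) ⊆ t
      s-agree i∈ = p∩q⊆p t (r - x) (subst (_ ∈_) eq i∈)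
      t-agree : t ∩ (r - x) ⊆ s
      t-agree i∈ = p∩q⊆p s (r - x) (subst (_ ∈_) (sym eq) i∈)

    length-invariant≤2^∣r-x∣ : ∀ k {ss} → Unique ss →
      All (λ s → Invariant s × ∣ s ∣ ≡ k) ss → length ss ≤ 2 ^ ∣ r - x ∣
    length-invariant≤2^∣r-x∣ k {ss} u ss-inv = begin
      length ss                      ≡⟨ sym (length-map (_∩ (r - x)) ss) ⟩
      length (map (_∩ (r - x)) ss)   ≤⟨ length-unique-⊆≤2^∣ r - x ∣ restrictions-unique restrictions-⊆ ⟩
      2 ^ ∣ r - x ∣                  ∎
      where
      open ≤-Reasoning
      restrictions-unique : Unique (map (_∩ (r - x)) ss)
      restrictions-unique = map⁺-injectiveOn
        (λ (s-inv , ∣s∣≡k) (t-inv , ∣t∣≡k) → invariant-injective s-inv t-inv (trans ∣s∣≡k (sym ∣t∣≡k)))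
        ss-inv u
      restrictions-⊆ : All (_⊆ r - x) (map (_∩ (r - x)) ss)
      restrictions-⊆ = All.map⁺ (All.universal (λ s {_} → p∩q⊆q s (r - x)) ss)

  module _ {_≼_ : Rel (Fin n) 0ℓ} (_≼?_ : Decidable₂ _≼_) where

    σ-upper : Subset n
    σ-upper = select (λ i → i ≼? σ i)

    σ-upper-transversal : Total _≼_ → Transversal σ-upper
    σ-upper-transversal total i with total i (σ i)
    ... | inj₁ i≼σi = inj₁ (∈-select⁺ (λ j → j ≼? σ j) i≼σi)
    ... | inj₂ σi≼i = inj₂ (∈-select⁺ (λ j → j ≼? σ j) (subst (σ i ≼_) (sym (σ-involutive i)) σi≼i))

  module _ (f : Subset n) (fixed⊆f : ∀ i → σ i ≡ i → i ∈ f) where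

    private
      up down : Subset n
      up   = σ-upper Fin._≤?_
      down = σ-upper (flip Fin._≤?_)

      up∩down⊆f : up ∩ down ⊆ f
      up∩down⊆f {i} i∈ = fixed⊆f i (sym (Fin.≤-antisym
        (∈-select⁻ (λ j → j Fin.≤? σ j) (proj₁ (x∈p∩q⁻ up down i∈)))
        (∈-select⁻ (λ j → σ j Fin.≤? j) (proj₂ (x∈p∩q⁻ up down i∈)))))

      ∣up∣+∣down∣≤ : ∣ up ∣ + ∣ down ∣ ≤ n + ∣ f ∣
      ∣up∣+∣down∣≤ = ≤-trans (≤-reflexive (∣p∣+∣q∣≡∣p∪q∣+∣p∩q∣ up down))
                             (+-mono-≤ (∣p∣≤n (up ∪ down)) (p⊆q⇒∣p∣≤∣q∣ up∩down⊆f))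

    small-transversal : ∃ λ r → Transversal r × 2 * ∣ r ∣ ≤ n + ∣ f ∣
    small-transversal with ∣ up ∣ ≤?ⁿ ∣ down ∣
    ... | yes ∣up∣≤∣down∣ =
      up , σ-upper-transversal Fin._≤?_ Fin.≤-total , ≤-trans (2*m≤m+n ∣up∣≤∣down∣) ∣up∣+∣down∣≤
    ... | no  ∣up∣≰∣down∣ =
      down , σ-upper-transversal (flip Fin._≤?_) (flip Fin.≤-total) ,
      ≤-trans (2*m≤m+n (≰⇒≥ ∣up∣≰∣down∣)) (≤-trans (≤-reflexive (+-comm ∣ down ∣ ∣ up ∣)) ∣up∣+∣down∣≤)

    length-invariant≤2^[c∸1] : 0 < n → ∀ k {ss} → Unique ss →
      All (λ s → Invariant s × ∣ s ∣ ≡ k) ss → length ss ≤ 2 ^ ((n + ∣ f ∣) / 2 ∸ 1)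
    length-invariant≤2^[c∸1] 0<n k {ss} u ss-inv with small-transversal
    ... | r , r-tr , 2∣r∣≤ with transversal-nonempty 0<n r-tr
    ... | x , x∈r = begin
      length ss                  ≤⟨ length-invariant≤2^∣r-x∣ r-tr x k u ss-inv ⟩
      2 ^ ∣ r - x ∣              ≤⟨ ^-monoʳ-≤ 2 (∸-monoˡ-≤ 1 ∣r∣≤c) ⟩
      2 ^ ((n + ∣ f ∣) / 2 ∸ 1)  ∎
      where
      open ≤-Reasoning
      ∣r∣≤c : suc ∣ r - x ∣ ≤ (n + ∣ f ∣) / 2
      ∣r∣≤c = ≤-trans (x∈p⇒∣p-x∣<∣p∣ x∈r) (2*m≤k⇒m≤k/2 2∣r∣≤)

module InverseIndex {c ℓ : Level} (G : Group c ℓ) {n : ℕ} {e : Fin n → Group.Carrier G}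
                    (e-injective : InjectiveEnum G e) (e-invClosed : InvClosedEnum G e) where

  open Group G using (_≈_; _∙_; ε; _⁻¹; ⁻¹-cong; ∙-congʳ; inverseˡ; setoid)
    renaming (trans to ≈-trans; sym to ≈-sym)
  open GroupProperties G using (⁻¹-involutive)

  inverseIndex : Fin n → Fin n
  inverseIndex i = proj₁ (e-invClosed i)

  e-inverseIndex : ∀ i → e (inverseIndex i) ≈ e i ⁻¹
  e-inverseIndex i = proj₂ (e-invClosed i)

  inverseIndex-involutive : ∀ i → inverseIndex (inverseIndex i) ≡ i
  inverseIndex-involutive i = e-injective _ _ (begin
    e (inverseIndex (inverseIndex i))  ≈⟨ e-inverseIndex (inverseIndex i) ⟩
    e (inverseIndex i) ⁻¹              ≈⟨ ⁻¹-cong (e-inverseIndex i) ⟩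
    e i ⁻¹ ⁻¹                          ≈⟨ ⁻¹-involutive (e i) ⟩
    e i                                ∎)
    where open Relation.Binary.Reasoning.Setoid setoid

  inverseIndex-fixed⇒e²≈ε : ∀ {i} → inverseIndex i ≡ i → e i ∙ e i ≈ ε
  inverseIndex-fixed⇒e²≈ε {i} σi≡i =
    ≈-trans (∙-congʳ (subst (λ j → e j ≈ e i ⁻¹) σi≡i (e-inverseIndex i))) (inverseˡ (e i))

  open Involution inverseIndex inverseIndex-involutive

  invClosedSub⇒invariant : ∀ {s} → InvClosedSub G e s → Invariant s
  invClosedSub⇒invariant {s} s-invClosed {i} i∈s with s-invClosed i i∈s
  ... | j , j∈s , ej≈ei⁻¹ =
    subst (_∈ s) (e-injective _ _ (≈-trans ej≈ei⁻¹ (≈-sym (e-inverseIndex i)))) j∈s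

lemma2p2 : ∀ {c ℓ : Level} (G : Group c ℓ) (n : ℕ) (e : Fin n → Group.Carrier G)
    → InjectiveEnum G e → InvClosedEnum G e → 0 < n
    → (I : Subset n) → IsInvolSet G e I
    → (k : ℕ) (L : List (Subset n)) → Unique L
    → All (λ S → InvClosedSub G e S × ∣ S ∣ ≡ k) L
    → length L ≤ 2 ^ (cX I ∸ 1)
lemma2p2 G n e e-injective e-invClosed 0<n I I-invol k L u L-invClosed =
  length-invariant≤2^[c∸1] I fixed⊆I 0<n k u
    (All.map (Product.map₁ invClosedSub⇒invariant) L-invClosed)
  where
  open InverseIndex G e-injective e-invClosed
  open Involution inverseIndex inverseIndex-involutive
  fixed⊆I : ∀ i → inverseIndex i ≡ i → i ∈ I
  fixed⊆I i σi≡i = proj₂ (I-invol i) (inverseIndex-fixed⇒e²≈ε σi≡i)
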